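{- Let $r$ and $c$ be integer sequences of length $m$ and $n$, respectively, and let $M$ be their merge matrix. Let $i\in[m]$ with $r(i)=\min(r)$ and $j\in[n]$ with $c(j)=\min(c)$. Let $k\in[m]\setminus\{i\}$ with $r(k)=\min_{x\in[m]\setminus\{i\}} r(x)$ and $\ell\in[n]\setminus\{j\}$ with $c(\ell)=\min_{y\in[n]\setminus\{j\}}c(y)$. Let $\vec p_{ru}=(1,1),(1,2),\ldots,(1,n),(2,n),\ldots,(m,n)$ and $\vec p_{ur}=(1,1),(2,1),\ldots,(m,1),(m,2),\ldots,(m,n)$, and let $\{p^*,q^*\}=\{\vec p_{ru},\vec p_{ur}\}$ be such that $\max(M[p^*])\le\max(M[q^*])$. (1) If $i=m$, $j=n$, $k=1$ and $\ell=1$, then $p^*$ dominates every path in $M$. (2) If $i=1$, $j=1$, $k=m$ and $\ell=n$, then $p^*$ dominates every path in $M$.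
   Context: The merge matrix of $r$ and $c$ is the $m\times n$ matrix with $M[i,j]=r(i)+c(j)$. A path in $M$ is a sequence $p(1),\ldots,p(L)$ of indices with $p(1)=(1,1)$, $p(L)=(m,n)$, and if $p(h)=(i,j)$ then $p(h+1)\in\{(i+1,j),(i,j+1),(i+1,j+1)\}$; $M[p]=M[p(1)],\ldots,M[p(L)]$. A path $p$ dominates a path $q$ if $M[p]$ dominates $M[q]$, where for integer sequences $a$ dominates $b$ if there are extensions $a^*$ of $a$ and $b^*$ of $b$ of equal length with $a^*(k)\le b^*(k)$ for all $k$; an extension is obtained by repeating each element one or more times consecutively, preserving order. -}

module Defs where

open import Data.Nat using (ℕ; zero; suc)
open import Data.Integer using (ℤ; _+_; _≤_; _⊔_; +_)
open import Data.Fin using (Fin; zero; suc; toℕ; fromℕ)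
open import Data.List using (List; []; _∷_; _++_; map; length; concat; zipWith; replicate; foldr; allFin)
open import Data.List.Relation.Binary.Pointwise using (Pointwise)
open import Data.Product using (Σ; _×_; _,_; ∃)
open import Data.Sum using (_⊎_)
open import Data.Empty using (⊥)
open import Relation.Binary.PropositionalEquality using (_≡_)

-- Convention: sequences of length m are indexed by Fin m, 0-based
-- (paper index 1 ↦ zero, paper index m ↦ fromℕ (m-1)).
-- Lengths are written suc m and suc n (the paper's lengths are ≥ 1, since (1,1) exists).

Extension : List ℤ → List ℤ → Set
Extension a a* = Σ (List ℕ) λ ks →
  length ks ≡ length a × a* ≡ concat (zipWith (λ x k → replicate (suc k) x) a ks)

Dominates : List ℤ → List ℤ → Set
Dominates a b = Σ (List ℤ) λ a* → Σ (List ℤ) λ b* →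
  Extension a a* × Extension b b* × Pointwise _≤_ a* b*

module _ {m n : ℕ} where

  Pos : Set
  Pos = Fin (suc m) × Fin (suc n)

  merge : (Fin (suc m) → ℤ) → (Fin (suc n) → ℤ) → Pos → ℤ
  merge r c (i , j) = r i + c j

  Step : Pos → Pos → Set
  Step (i , j) (i' , j') =
      (toℕ i' ≡ suc (toℕ i) × j' ≡ j)
    ⊎ (i' ≡ i × toℕ j' ≡ suc (toℕ j))
    ⊎ (toℕ i' ≡ suc (toℕ i) × toℕ j' ≡ suc (toℕ j))

  Walk : Pos → List Pos → Set
  Walk p [] = p ≡ (fromℕ m , fromℕ n)
  Walk p (q ∷ qs) = Step p q × Walk q qs

  IsPath : List Pos → Set
  IsPath [] = ⊥
  IsPath (p ∷ ps) = p ≡ (zero , zero) × Walk p ps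

  entries : (Pos → ℤ) → List Pos → List ℤ
  entries M p = map M p

  p-ru : List Pos
  p-ru = map (λ j → (zero , j)) (allFin (suc n)) ++ map (λ i → (suc i , fromℕ n)) (allFin m)

  p-ur : List Pos
  p-ur = map (λ i → (i , zero)) (allFin (suc m)) ++ map (λ j → (fromℕ m , suc j)) (allFin n)

-- maximum of a nonempty list (only applied to nonempty lists; [] ↦ 0 is an unused default)
maxList : List ℤ → ℤ
maxList [] = + 0
maxList (x ∷ xs) = foldr _⊔_ x xs

module Submission where

-- By transposition it suffices to treat p* = p_ru. Let b be a point of the path q at which M[q]
-- is maximal; the hypothesis max M[p*] ≤ max M[q*] yields max M[p_ru] ≤ M[b]. Before b, each
-- point (x,y) of q is matched with the point (1,y) of p_ru, which needs r(1) ≤ r(x); from b on,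
-- with the point (x,n), which needs c(n) ≤ c(y); and the whole stretch of p_ru from (1,y_b) to
-- (x_b,n) is matched with b itself. The minimality assumptions give both inequalities, except in
-- the row or column of the overall minimum, where M[b] ≥ max M[p_ru] supplies them.

open import Defs
open import Data.Nat as ℕ using (ℕ; zero; suc; z≤n; s≤s; _∸_; _≤′_; ≤′-refl; ≤′-step)
import Data.Nat.Properties as ℕₚ
open import Data.Integer using (ℤ; _≤_; _+_; _⊔_)
import Data.Integer.Properties as ℤₚ
open import Data.Fin using (Fin; zero; suc; fromℕ; toℕ; _≟_)
import Data.Fin.Properties as Finₚ
open import Data.List using (List; []; _∷_; _++_; map; allFin; tabulate)
open import Data.List.Properties
  using (map-++; map-∘; map-cong; map-tabulate; foldr-preservesᵇ; foldr-preservesᵒ)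
open import Data.List.Relation.Binary.Pointwise using ([]; _∷_)
open import Data.List.Relation.Unary.All as All using (All; []; _∷_)
open import Data.List.Relation.Unary.All.Properties using (map⁺)
open import Data.List.Relation.Unary.Any as Any using (here; there)
open import Data.List.Membership.Propositional using (_∈_)
open import Data.List.Membership.Propositional.Properties
  using (∈-map⁺; ∈-map⁻; ∈-++⁺ˡ; ∈-++⁺ʳ; ∈-++⁻; ∈-allFin)
open import Data.Product using (_×_; _,_; ∃; proj₁; proj₂; swap)
open import Data.Sum using (_⊎_; inj₁; inj₂)
open import Data.Empty using (⊥; ⊥-elim)
open import Function using (_∘_)
open import Relation.Binary.PropositionalEquality
open import Relation.Nullary using (yes; no)

private
  variable
    A : Set
    x y : ℤ
    xs ys xs* : List ℤ

Extension-∷ : Extension xs xs* → Extension (x ∷ xs) (x ∷ xs*)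
Extension-∷ (ks , len , eq) = 0 ∷ ks , cong suc len , cong (_ ∷_) eq

Extension-repeat : Extension (x ∷ xs) xs* → Extension (x ∷ xs) (x ∷ xs*)
Extension-repeat ([] , () , _)
Extension-repeat (k ∷ ks , len , eq) = suc k ∷ ks , len , cong (_ ∷_) eq

dominates-[] : Dominates [] []
dominates-[] = [] , [] , ([] , refl , refl) , ([] , refl , refl) , []

dominates-∷ : x ≤ y → Dominates xs ys → Dominates (x ∷ xs) (y ∷ ys)
dominates-∷ x≤y (_ , _ , ext₁ , ext₂ , pw) =
  _ , _ , Extension-∷ ext₁ , Extension-∷ ext₂ , x≤y ∷ pw

dominates-∷ˡ : x ≤ y → Dominates xs (y ∷ ys) → Dominates (x ∷ xs) (y ∷ ys)
dominates-∷ˡ x≤y (_ , _ , ext₁ , ext₂ , pw) =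
  _ , _ , Extension-∷ ext₁ , Extension-repeat ext₂ , x≤y ∷ pw

dominates-∷ʳ : x ≤ y → Dominates (x ∷ xs) ys → Dominates (x ∷ xs) (y ∷ ys)
dominates-∷ʳ x≤y (_ , _ , ext₁ , ext₂ , pw) =
  _ , _ , Extension-repeat ext₁ , Extension-∷ ext₂ , x≤y ∷ pw

maxList-upper : ∀ {z} x xs → z ∈ x ∷ xs → z ≤ maxList (x ∷ xs)
maxList-upper {z} x xs z∈ = foldr-preservesᵒ lift x xs (bound z∈)
  where
  lift : ∀ a b → z ≤ a ⊎ z ≤ b → z ≤ a ⊔ b
  lift a b (inj₁ z≤a) = ℤₚ.≤-trans z≤a (ℤₚ.i≤i⊔j a b)
  lift a b (inj₂ z≤b) = ℤₚ.≤-trans z≤b (ℤₚ.i≤j⊔i a b)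
  bound : z ∈ x ∷ xs → z ≤ x ⊎ Any.Any (z ≤_) xs
  bound (here refl) = inj₁ ℤₚ.≤-refl
  bound (there z∈) = inj₂ (Any.map ℤₚ.≤-reflexive z∈)

maxList-least : ∀ {u} x xs → All (_≤ u) (x ∷ xs) → maxList (x ∷ xs) ≤ u
maxList-least x xs (x≤u ∷ xs≤u) = foldr-preservesᵇ ℤₚ.⊔-lub x≤u xs≤u

maxList-∈ : ∀ x xs → maxList (x ∷ xs) ∈ x ∷ xs
maxList-∈ x xs = foldr-preservesᵇ select (here refl) (All.tabulate there)
  where
  select : ∀ {a b} → a ∈ x ∷ xs → b ∈ x ∷ xs → a ⊔ b ∈ x ∷ xs
  select {a} {b} a∈ b∈ with ℤₚ.⊔-sel a b
  ... | inj₁ a⊔b≡a = subst (_∈ _) (sym a⊔b≡a) a∈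
  ... | inj₂ a⊔b≡b = subst (_∈ _) (sym a⊔b≡b) b∈

module _ {B : Set} (f : B → ℤ) where

  maxList-map-attained : ∀ b bs → ∃ λ b′ → b′ ∈ b ∷ bs × maxList (map f (b ∷ bs)) ≡ f b′
  maxList-map-attained b bs = ∈-map⁻ f (maxList-∈ (f b) (map f bs))

  maxList-map-upper : ∀ {b′} b bs → b′ ∈ b ∷ bs → f b′ ≤ maxList (map f (b ∷ bs))
  maxList-map-upper b bs b′∈ = maxList-upper (f b) (map f bs) (∈-map⁺ f b′∈)

  maxList-map-≤ : ∀ a as b bs →
                  (∀ {a′} → a′ ∈ a ∷ as → ∃ λ b′ → b′ ∈ b ∷ bs × f a′ ≤ f b′) →
                  maxList (map f (a ∷ as)) ≤ maxList (map f (b ∷ bs))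
  maxList-map-≤ a as b bs covered = maxList-least (f a) (map f as) (map⁺ (All.tabulate bound))
    where
    bound : ∀ {a′} → a′ ∈ a ∷ as → f a′ ≤ maxList (map f (b ∷ bs))
    bound a′∈ with covered a′∈
    ... | b′ , b′∈ , le = ℤₚ.≤-trans le (maxList-map-upper b bs b′∈)

  maxList-map-≤⁻ : ∀ a as b bs → maxList (map f (a ∷ as)) ≤ maxList (map f (b ∷ bs)) →
                   ∀ {a′} → a′ ∈ a ∷ as → ∃ λ b′ → b′ ∈ b ∷ bs × f a′ ≤ f b′
  maxList-map-≤⁻ a as b bs max≤ a′∈ with maxList-map-attained b bs
  ... | b′ , b′∈ , eq =
    b′ , b′∈ , subst (f _ ≤_) eq (ℤₚ.≤-trans (maxList-map-upper a as a′∈) max≤)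

+-cancelʳ-≤ : ∀ {a b} z → a + z ≤ b + z → a ≤ b
+-cancelʳ-≤ z a+z≤b+z = ℤₚ.≮⇒≥ (λ b<a → ℤₚ.<⇒≱ (ℤₚ.+-monoˡ-< z b<a) a+z≤b+z)

+-cancelˡ-≤ : ∀ {a b} z → z + a ≤ z + b → a ≤ b
+-cancelˡ-≤ {a} {b} z = +-cancelʳ-≤ z ∘ subst₂ _≤_ (ℤₚ.+-comm z a) (ℤₚ.+-comm z b)

infix 4 _⇝_
_⇝_ : ℕ → ℕ → Set
a ⇝ b = b ≡ a ⊎ b ≡ suc a

⇝⇒≤ : ∀ {a b} → a ⇝ b → a ℕ.≤ b
⇝⇒≤ (inj₁ refl) = ℕₚ.≤-refl
⇝⇒≤ (inj₂ refl) = ℕₚ.n≤1+n _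

⇝-<⇒≤ : ∀ {a b t} → a ⇝ b → a ℕ.< t → b ℕ.≤ t
⇝-<⇒≤ (inj₁ refl) a<t = ℕₚ.<⇒≤ a<t
⇝-<⇒≤ (inj₂ refl) a<t = a<t

+-⇝ : ∀ k {a b} → a ⇝ b → k ℕ.+ a ⇝ k ℕ.+ b
+-⇝ k (inj₁ refl) = inj₁ refl
+-⇝ k {a} (inj₂ refl) = inj₂ (ℕₚ.+-suc k a)

interval : ℕ → ℕ → List ℕ
interval a zero = []
interval a (suc k) = a ∷ interval (suc a) k

interval-++ : ∀ a k l → interval a (k ℕ.+ l) ≡ interval a k ++ interval (a ℕ.+ k) l
interval-++ a zero l = cong (λ b → interval b l) (sym (ℕₚ.+-identityʳ a))
interval-++ a (suc k) l = cong (a ∷_) (begin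
    interval (suc a) (k ℕ.+ l)
  ≡⟨ interval-++ (suc a) k l ⟩
    interval (suc a) k ++ interval (suc a ℕ.+ k) l
  ≡⟨ cong (λ b → interval (suc a) k ++ interval b l) (sym (ℕₚ.+-suc a k)) ⟩
    interval (suc a) k ++ interval (a ℕ.+ suc k) l ∎)
  where open ≡-Reasoning

∈-interval : ∀ {a t} k → a ℕ.≤ t → t ℕ.< a ℕ.+ k → t ∈ interval a k
∈-interval {a} zero a≤t t<a+0 =
  ⊥-elim (ℕₚ.<⇒≱ (subst (_ ℕ.<_) (ℕₚ.+-identityʳ a) t<a+0) a≤t)
∈-interval {a} {t} (suc k) a≤t t<a+k with a ℕₚ.≟ t
... | yes refl = here refl
... | no a≢t =
  there (∈-interval k (ℕₚ.≤∧≢⇒< a≤t a≢t) (subst (t ℕ.<_) (ℕₚ.+-suc a k) t<a+k))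

map-interval : ∀ (g : ℕ → A) a k (f : Fin k → A) → (∀ j → g (a ℕ.+ toℕ j) ≡ f j) →
               map g (interval a k) ≡ tabulate f
map-interval g a zero f g≗f = refl
map-interval g a (suc k) f g≗f = cong₂ _∷_
  (trans (cong g (sym (ℕₚ.+-identityʳ a))) (g≗f zero))
  (map-interval g (suc a) k (f ∘ suc)
    (λ j → trans (cong g (sym (ℕₚ.+-suc a (toℕ j)))) (g≗f (suc j))))

-- Coupled a ws: v a, v (a+1), …, v E and ws can be traversed in lockstep, each move advancing
-- one or both of them, with the current entry of the first never exceeding that of ws.
module _ (v : ℕ → ℤ) (E : ℕ) where

  data Coupled : ℕ → List ℤ → Set where
    end   : ∀ {a w} → a ≡ E → v a ≤ w → Coupled a (w ∷ [])
    stepˡ : ∀ {a w ws} → v a ≤ w → Coupled (suc a) (w ∷ ws) → Coupled a (w ∷ ws)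
    stepʳ : ∀ {a w w′ ws} → v a ≤ w → Coupled a (w′ ∷ ws) → Coupled a (w ∷ w′ ∷ ws)
    step  : ∀ {a w w′ ws} → v a ≤ w → Coupled (suc a) (w′ ∷ ws) → Coupled a (w ∷ w′ ∷ ws)

  advance : ∀ {a b w w′ ws} → a ⇝ b → v a ≤ w → Coupled b (w′ ∷ ws) → Coupled a (w ∷ w′ ∷ ws)
  advance (inj₁ refl) v≤w c = stepʳ v≤w c
  advance (inj₂ refl) v≤w c = step v≤w c

  Coupled⇒≤ : ∀ {a ws} → Coupled a ws → a ℕ.≤ E
  Coupled⇒≤ (end refl _) = ℕₚ.≤-refl
  Coupled⇒≤ (stepˡ _ c) = ℕₚ.<⇒≤ (Coupled⇒≤ c)
  Coupled⇒≤ (stepʳ _ c) = Coupled⇒≤ c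
  Coupled⇒≤ (step _ c) = ℕₚ.<⇒≤ (Coupled⇒≤ c)

  Coupled⇒Dominates : ∀ {ws} → Coupled 0 ws → Dominates (map v (interval 0 (suc E))) ws
  Coupled⇒Dominates = dominates E refl
    where
    shift : ∀ {a} k → a ℕ.+ suc k ≡ E → suc a ℕ.+ k ≡ E
    shift {a} k = trans (sym (ℕₚ.+-suc a k))

    past-end : ∀ {a ws} → a ℕ.+ 0 ≡ E → Coupled (suc a) ws → ⊥
    past-end {a} a+0≡E c = ℕₚ.<-irrefl (trans (sym (ℕₚ.+-identityʳ a)) a+0≡E) (Coupled⇒≤ c)

    dominates : ∀ {a ws} k → a ℕ.+ k ≡ E → Coupled a ws → Dominates (map v (interval a (suc k))) ws
    dominates zero _ (end _ v≤w) = dominates-∷ v≤w dominates-[]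
    dominates {a} (suc k) a+k≡E (end refl _) = ⊥-elim (ℕₚ.m+1+n≢m a a+k≡E)
    dominates zero a+0≡E (stepˡ _ c) = ⊥-elim (past-end a+0≡E c)
    dominates (suc k) a+k≡E (stepˡ v≤w c) = dominates-∷ˡ v≤w (dominates k (shift k a+k≡E) c)
    dominates k a+k≡E (stepʳ v≤w c) = dominates-∷ʳ v≤w (dominates k a+k≡E c)
    dominates zero a+0≡E (step _ c) = ⊥-elim (past-end a+0≡E c)
    dominates (suc k) a+k≡E (step v≤w c) = dominates-∷ v≤w (dominates k (shift k a+k≡E) c)

  skip : ∀ {a b w ws} → a ℕ.≤ b → (∀ t → t ℕ.≤ E → v t ≤ w) →
         Coupled b (w ∷ ws) → Coupled a (w ∷ ws)
  skip {w = w} {ws} a≤b below = go (ℕₚ.≤⇒≤′ a≤b)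
    where
    go : ∀ {a b} → a ≤′ b → Coupled b (w ∷ ws) → Coupled a (w ∷ ws)
    go ≤′-refl c = c
    go (≤′-step a≤′b) c = go a≤′b (stepˡ (below _ (ℕₚ.<⇒≤ (Coupled⇒≤ c))) c)

≥fromℕ⇒≡fromℕ : ∀ {k} {x : Fin (suc k)} → toℕ (fromℕ k) ℕ.≤ toℕ x → x ≡ fromℕ k
≥fromℕ⇒≡fromℕ {x = x} = Finₚ.≤-antisym (Finₚ.≤fromℕ x)

clamp : ∀ {k} → ℕ → Fin (suc k)
clamp zero = zero
clamp {zero} (suc t) = zero
clamp {suc k} (suc t) = suc (clamp t)

clamp-toℕ : ∀ {k} (i : Fin (suc k)) → clamp (toℕ i) ≡ i
clamp-toℕ zero = refl
clamp-toℕ {suc k} (suc i) = cong suc (clamp-toℕ i)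

clamp-≥ : ∀ {k} t → k ℕ.≤ t → clamp {k} t ≡ fromℕ k
clamp-≥ {zero} zero _ = refl
clamp-≥ {zero} (suc t) _ = refl
clamp-≥ {suc k} (suc t) (s≤s k≤t) = cong suc (clamp-≥ t k≤t)

module _ {m n : ℕ} where

  row : Pos {m} {n} → ℕ
  row = toℕ ∘ proj₁

  col : Pos {m} {n} → ℕ
  col = toℕ ∘ proj₂

  infix 4 _≤ₚ_
  _≤ₚ_ : Pos {m} {n} → Pos {m} {n} → Set
  p ≤ₚ q = row p ℕ.≤ row q × col p ℕ.≤ col q

  ≤ₚ-refl : ∀ {p} → p ≤ₚ p
  ≤ₚ-refl = ℕₚ.≤-refl , ℕₚ.≤-refl

  ≤ₚ-trans : ∀ {p q s} → p ≤ₚ q → q ≤ₚ s → p ≤ₚ s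
  ≤ₚ-trans (r₁ , c₁) (r₂ , c₂) = ℕₚ.≤-trans r₁ r₂ , ℕₚ.≤-trans c₁ c₂

  Step-row : ∀ {p q} → Step p q → row p ⇝ row q
  Step-row (inj₁ (next , _)) = inj₂ next
  Step-row (inj₂ (inj₁ (same , _))) = inj₁ (cong toℕ same)
  Step-row (inj₂ (inj₂ (next , _))) = inj₂ next

  Step-transpose : ∀ {p q} → Step {m} {n} p q → Step {n} {m} (swap p) (swap q)
  Step-transpose (inj₁ (i≡ , j≡)) = inj₂ (inj₁ (j≡ , i≡))
  Step-transpose (inj₂ (inj₁ (i≡ , j≡))) = inj₁ (j≡ , i≡)
  Step-transpose (inj₂ (inj₂ (i≡ , j≡))) = inj₂ (inj₂ (j≡ , i≡))

  Walk-transpose : ∀ {p} ps → Walk {m} {n} p ps → Walk {n} {m} (swap p) (map swap ps)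
  Walk-transpose [] p≡end = cong swap p≡end
  Walk-transpose (q ∷ qs) (s , w) = Step-transpose s , Walk-transpose qs w

  IsPath-transpose : ∀ q → IsPath {m} {n} q → IsPath {n} {m} (map swap q)
  IsPath-transpose (p ∷ ps) (p≡start , w) = cong swap p≡start , Walk-transpose ps w

  p-ru-transpose : map swap (p-ru {m} {n}) ≡ p-ur {n} {m}
  p-ru-transpose =
    trans (map-++ swap (map (zero ,_) (allFin (suc n))) (map (λ i → suc i , fromℕ n) (allFin m)))
    (cong₂ _++_ (sym (map-∘ (allFin (suc n)))) (sym (map-∘ (allFin m))))

  p-ur-transpose : map swap (p-ur {m} {n}) ≡ p-ru {n} {m}
  p-ur-transpose =
    trans (map-++ swap (map (_, zero) (allFin (suc m))) (map (λ j → fromℕ m , suc j) (allFin n)))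
    (cong₂ _++_ (sym (map-∘ (allFin (suc m)))) (sym (map-∘ (allFin n))))

  ∈-p-ru⁻ : ∀ {p} → p ∈ p-ru {m} {n} →
            (∃ λ y → p ≡ (zero , y)) ⊎ (∃ λ x → p ≡ (suc x , fromℕ n))
  ∈-p-ru⁻ p∈ with ∈-++⁻ (map (zero ,_) (allFin (suc n))) p∈
  ... | inj₁ p∈row = let y , _ , eq = ∈-map⁻ (zero ,_) p∈row in inj₁ (y , eq)
  ... | inj₂ p∈col = let x , _ , eq = ∈-map⁻ (λ i → suc i , fromℕ n) p∈col in inj₂ (x , eq)

  ∈-p-ur⁻ : ∀ {p} → p ∈ p-ur {m} {n} →
            (∃ λ x → p ≡ (x , zero)) ⊎ (∃ λ y → p ≡ (fromℕ m , suc y))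
  ∈-p-ur⁻ p∈ with ∈-++⁻ (map (_, zero) (allFin (suc m))) p∈
  ... | inj₁ p∈col = let x , _ , eq = ∈-map⁻ (_, zero) p∈col in inj₁ (x , eq)
  ... | inj₂ p∈row = let y , _ , eq = ∈-map⁻ (λ j → fromℕ m , suc j) p∈row in inj₂ (y , eq)

  firstRow∈p-ru : ∀ y → (zero , y) ∈ p-ru {m} {n}
  firstRow∈p-ru y = ∈-++⁺ˡ (∈-map⁺ (zero ,_) (∈-allFin y))

  lastCol∈p-ru : ∀ x → (x , fromℕ n) ∈ p-ru {m} {n}
  lastCol∈p-ru zero = firstRow∈p-ru (fromℕ n)
  lastCol∈p-ru (suc x) =
    ∈-++⁺ʳ (map (zero ,_) (allFin (suc n))) (∈-map⁺ (λ i → suc i , fromℕ n) (∈-allFin x))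

merge-transpose : ∀ {m n} (r : Fin (suc m) → ℤ) (c : Fin (suc n) → ℤ) (ps : List (Pos {m} {n})) →
                  map (merge c r) (map swap ps) ≡ map (merge r c) ps
merge-transpose r c ps =
  trans (sym (map-∘ ps)) (map-cong (λ p → ℤₚ.+-comm (c (proj₂ p)) (r (proj₁ p))) ps)

module _ {m n : ℕ} where

  Step-col : ∀ {p q} → Step {m} {n} p q → col p ⇝ col q
  Step-col s = Step-row (Step-transpose s)

  Step⇒≤ₚ : ∀ {p q} → Step {m} {n} p q → p ≤ₚ q
  Step⇒≤ₚ s = ⇝⇒≤ (Step-row s) , ⇝⇒≤ (Step-col s)

  Walk-upward : ∀ {p} ps → Walk {m} {n} p ps → All (p ≤ₚ_) (p ∷ ps)
  Walk-upward [] _ = ≤ₚ-refl ∷ []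
  Walk-upward (q ∷ qs) (s , w) = ≤ₚ-refl ∷ All.map (≤ₚ-trans (Step⇒≤ₚ s)) (Walk-upward qs w)

  Walk-comparable : ∀ {p a b} ps → Walk {m} {n} p ps → a ∈ p ∷ ps → b ∈ p ∷ ps → a ≤ₚ b ⊎ b ≤ₚ a
  Walk-comparable ps w (here refl) b∈ = inj₁ (All.lookup (Walk-upward ps w) b∈)
  Walk-comparable ps w (there a∈) (here refl) = inj₂ (All.lookup (Walk-upward ps w) (there a∈))
  Walk-comparable (q ∷ qs) (_ , w) (there a∈) (there b∈) = Walk-comparable qs w a∈ b∈

  Walk-meetsRow : ∀ {p} ps → Walk {m} {n} p ps → ∀ x → row p ℕ.≤ toℕ x →
                  ∃ λ p′ → p′ ∈ p ∷ ps × proj₁ p′ ≡ x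
  Walk-meetsRow [] refl x m≤x = _ , here refl , sym (≥fromℕ⇒≡fromℕ m≤x)
  Walk-meetsRow {p} (q ∷ qs) (s , w) x p≤x with proj₁ p ≟ x
  ... | yes p≡x = p , here refl , p≡x
  ... | no p≢x =
    let p<x = ℕₚ.≤∧≢⇒< p≤x (p≢x ∘ Finₚ.toℕ-injective)
        p′ , p′∈ , p′≡x = Walk-meetsRow qs w x (⇝-<⇒≤ (Step-row s) p<x)
    in p′ , there p′∈ , p′≡x

module _ {m n : ℕ} where

  Walk-meetsCol : ∀ {p} ps → Walk {m} {n} p ps → ∀ y → col p ℕ.≤ toℕ y →
                  ∃ λ p′ → p′ ∈ p ∷ ps × proj₂ p′ ≡ y
  Walk-meetsCol {p} ps w y p≤y with Walk-meetsRow (map swap ps) (Walk-transpose ps w) y p≤y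
  ... | p′ , p′∈ , p′≡y with ∈-map⁻ swap {xs = p ∷ ps} p′∈
  ...   | p″ , p″∈ , refl = p″ , p″∈ , p′≡y

  IsPath-meetsRow : ∀ {q} → IsPath {m} {n} q → ∀ x → ∃ λ p → p ∈ q × proj₁ p ≡ x
  IsPath-meetsRow {p ∷ ps} (refl , w) x = Walk-meetsRow ps w x z≤n

  IsPath-meetsCol : ∀ {q} → IsPath {m} {n} q → ∀ y → ∃ λ p → p ∈ q × proj₂ p ≡ y
  IsPath-meetsCol {p ∷ ps} (refl , w) y = Walk-meetsCol ps w y z≤n

  IsPath-comparable : ∀ {q a b} → IsPath {m} {n} q → a ∈ q → b ∈ q → a ≤ₚ b ⊎ b ≤ₚ a
  IsPath-comparable {p ∷ ps} (_ , w) = Walk-comparable ps w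

module RightUp {m n : ℕ} (r : Fin (suc m) → ℤ) (c : Fin (suc n) → ℤ) where

  W : Pos {m} {n} → ℤ
  W = merge r c

  ruMax : ℤ
  ruMax = maxList (map W p-ru)

  ruPos : ℕ → Pos {m} {n}
  ruPos t = clamp (t ∸ n) , clamp t

  ruPos-firstRow : ∀ y → ruPos (toℕ y) ≡ (zero , y)
  ruPos-firstRow y = cong₂ _,_ (cong clamp (ℕₚ.m≤n⇒m∸n≡0 (Finₚ.toℕ≤pred[n] y))) (clamp-toℕ y)

  ruPos-lastCol : ∀ x → ruPos (n ℕ.+ toℕ x) ≡ (x , fromℕ n)
  ruPos-lastCol x = cong₂ _,_ (trans (cong clamp (ℕₚ.m+n∸m≡n n (toℕ x))) (clamp-toℕ x))
                              (clamp-≥ _ (ℕₚ.m≤m+n n (toℕ x)))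

  p-ru-interval : p-ru {m} {n} ≡ map ruPos (interval 0 (suc (n ℕ.+ m)))
  p-ru-interval = sym (begin
      map ruPos (interval 0 (suc n ℕ.+ m))
    ≡⟨ cong (map ruPos) (interval-++ 0 (suc n) m) ⟩
      map ruPos (interval 0 (suc n) ++ interval (suc n) m)
    ≡⟨ map-++ ruPos (interval 0 (suc n)) (interval (suc n) m) ⟩
      map ruPos (interval 0 (suc n)) ++ map ruPos (interval (suc n) m)
    ≡⟨ cong₂ _++_ (map-interval ruPos 0 (suc n) _ ruPos-firstRow)
                  (map-interval ruPos (suc n) m _ lastCol) ⟩
      tabulate (zero ,_) ++ tabulate (λ x → suc x , fromℕ n)
    ≡⟨ cong₂ _++_ (sym (map-tabulate (λ y → y) (zero ,_))) (sym (map-tabulate (λ x → x) _)) ⟩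
      p-ru ∎)
    where
    open ≡-Reasoning
    lastCol : ∀ x → ruPos (suc n ℕ.+ toℕ x) ≡ (suc x , fromℕ n)
    lastCol x = trans (cong ruPos (sym (ℕₚ.+-suc n (toℕ x)))) (ruPos-lastCol (suc x))

  ruEntry : ℕ → ℤ
  ruEntry = W ∘ ruPos

  E : ℕ
  E = n ℕ.+ m

  p-ru-entries : map W p-ru ≡ map ruEntry (interval 0 (suc E))
  p-ru-entries = trans (cong (map W) p-ru-interval) (sym (map-∘ (interval 0 (suc E))))

  ruEntry≤ruMax : ∀ t → t ℕ.≤ E → ruEntry t ≤ ruMax
  ruEntry≤ruMax t t≤E = maxList-map-upper W _ _
    (subst (ruPos t ∈_) (sym p-ru-interval) (∈-map⁺ ruPos (∈-interval (suc E) z≤n (s≤s t≤E))))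

  Covered : List (Pos {m} {n}) → Pos {m} {n} → Set
  Covered q u = ∃ λ p → p ∈ q × W u ≤ W p

  covered-≤ : ∀ {q u u′} → W u ≤ W u′ → Covered q u′ → Covered q u
  covered-≤ u≤u′ (p , p∈ , u′≤p) = p , p∈ , ℤₚ.≤-trans u≤u′ u′≤p

  MatchedInColumn : Pos {m} {n} → Set
  MatchedInColumn p = ruEntry (col p) ≤ W p

  MatchedInRow : Pos {m} {n} → Set
  MatchedInRow p = ruEntry (n ℕ.+ row p) ≤ W p

  matchedInColumn : ∀ {x y} → r zero ≤ r x → MatchedInColumn (x , y)
  matchedInColumn {x} {y} r₀≤rₓ =
    subst (_≤ W (x , y)) (sym (cong W (ruPos-firstRow y))) (ℤₚ.+-monoˡ-≤ (c y) r₀≤rₓ)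

  matchedInRow : ∀ {x y} → c (fromℕ n) ≤ c y → MatchedInRow (x , y)
  matchedInRow {x} {y} cₙ≤c =
    subst (_≤ W (x , y)) (sym (cong W (ruPos-lastCol x))) (ℤₚ.+-monoʳ-≤ (r x) cₙ≤c)

  couple-byRow : ∀ {p} ps → Walk p ps → All MatchedInRow (p ∷ ps) →
                 Coupled ruEntry E (n ℕ.+ row p) (map W (p ∷ ps))
  couple-byRow [] refl (ok ∷ []) = end (cong (n ℕ.+_) (Finₚ.toℕ-fromℕ m)) ok
  couple-byRow (q ∷ qs) (s , w) (ok ∷ oks) =
    advance ruEntry E (+-⇝ n (Step-row s)) ok (couple-byRow qs w oks)

  couple-byColumn : ∀ {p b} ps → Walk p ps → b ∈ p ∷ ps →
                    (∀ {p′} → p′ ≤ₚ b → MatchedInColumn p′) →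
                    (∀ {p′} → b ≤ₚ p′ → MatchedInRow p′) →
                    ruMax ≤ W b → Coupled ruEntry E (col p) (map W (p ∷ ps))
  couple-byColumn {p} ps w (here refl) _ matchedʳ peak =
    skip ruEntry E (ℕₚ.≤-trans (Finₚ.toℕ≤pred[n] (proj₂ p)) (ℕₚ.m≤m+n n (row p)))
      (λ t t≤E → ℤₚ.≤-trans (ruEntry≤ruMax t t≤E) peak)
      (couple-byRow ps w (All.map matchedʳ (Walk-upward ps w)))
  couple-byColumn (q ∷ qs) (s , w) (there b∈) matchedᶜ matchedʳ peak =
    advance ruEntry E (Step-col s) (matchedᶜ (All.lookup (Walk-upward (q ∷ qs) (s , w)) (there b∈)))
      (couple-byColumn qs w b∈ matchedᶜ matchedʳ peak)

  p-ru-dominates :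
    (∀ {x y b} → (x , y) ≤ₚ b → ruMax ≤ W b → r zero ≤ r x) →
    (∀ {x y b} → b ≤ₚ (x , y) → ruMax ≤ W b → c (fromℕ n) ≤ c y) →
    ∀ q → IsPath q → ruMax ≤ maxList (map W q) → Dominates (map W p-ru) (map W q)
  p-ru-dominates colBound rowBound (p ∷ ps) (refl , w) ru≤q with maxList-map-attained W p ps
  ... | b , b∈ , max≡Wb = subst (λ xs → Dominates xs (map W (p ∷ ps))) (sym p-ru-entries)
    (Coupled⇒Dominates ruEntry E
      (couple-byColumn ps w b∈ (λ le → matchedInColumn (colBound le peak))
                               (λ le → matchedInRow (rowBound le peak)) peak))
    where
    peak : ruMax ≤ W b
    peak = subst (ruMax ≤_) max≡Wb ru≤q

module MinimaLast {m n : ℕ} {r : Fin (suc m) → ℤ} {c : Fin (suc n) → ℤ}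
  (r-min : ∀ x → r (fromℕ m) ≤ r x) (r-next : ∀ x → x ≢ fromℕ m → r zero ≤ r x)
  (c-min : ∀ y → c (fromℕ n) ≤ c y) (c-next : ∀ y → y ≢ fromℕ n → c zero ≤ c y) where

  open RightUp r c hiding (p-ru-dominates)

  colBound : ∀ {x y b} → (x , y) ≤ₚ b → ruMax ≤ W b → r zero ≤ r x
  colBound {x} {_} {xb , yb} (x≤xb , _) peak with x ≟ fromℕ m
  ... | no x≢m = r-next x x≢m
  ... | yes refl = +-cancelʳ-≤ (c yb)
                     (subst (λ x′ → W (zero , yb) ≤ W (x′ , yb)) (≥fromℕ⇒≡fromℕ x≤xb)
                       (ℤₚ.≤-trans (maxList-map-upper W _ _ (firstRow∈p-ru yb)) peak))

  module _ {q : List (Pos {m} {n})} (path : IsPath q) where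

    lastCol-covered : ∀ x → Covered q (suc x , fromℕ n)
    lastCol-covered x with IsPath-meetsRow path (suc x)
    ... | (_ , y) , p∈ , refl = _ , p∈ , ℤₚ.+-monoʳ-≤ (r (suc x)) (c-min y)

    p-ur-covered : ∀ {y} → (fromℕ m , y) ∈ q → y ≢ fromℕ n → ∀ {u} → u ∈ p-ur → Covered q u
    p-ur-covered {y} my∈ y≢n u∈ with ∈-p-ur⁻ u∈
    ... | inj₂ (j , refl) with IsPath-meetsCol path (suc j)
    ...   | (x , _) , p∈ , refl = _ , p∈ , ℤₚ.+-monoˡ-≤ (c (suc j)) (r-min x)
    p-ur-covered {y} my∈ y≢n u∈ | inj₁ (x , refl) with x ≟ fromℕ m
    ... | yes refl = _ , my∈ , ℤₚ.+-monoʳ-≤ (r x) (c-next y y≢n)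
    ... | no x≢m with IsPath-meetsRow path x
    ...   | (_ , y′) , p∈ , refl = _ , p∈ , ℤₚ.+-monoʳ-≤ (r x) (c-next y′ y′≢n)
      where
      y′≤y : toℕ y′ ℕ.≤ toℕ y
      y′≤y with IsPath-comparable path p∈ my∈
      ... | inj₁ (_ , y′≤y) = y′≤y
      ... | inj₂ (m≤x , _) = ⊥-elim (x≢m (≥fromℕ⇒≡fromℕ m≤x))
      y′≢n : y′ ≢ fromℕ n
      y′≢n refl = y≢n (≥fromℕ⇒≡fromℕ y′≤y)

    firstRow-covered : maxList (map W p-ru) ≤ maxList (map W p-ur) → ∀ y → Covered q (zero , y)
    firstRow-covered ur≤ru y with IsPath-meetsCol path y
    ... | (x , _) , p∈ , refl with x ≟ fromℕ m
    ...   | no x≢m = _ , p∈ , ℤₚ.+-monoˡ-≤ (c y) (r-next x x≢m)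
    ...   | yes refl with y ≟ fromℕ n
    ...     | no y≢n = let u , u∈ , le = maxList-map-≤⁻ W _ _ _ _ ur≤ru (firstRow∈p-ru y)
                       in covered-≤ le (p-ur-covered p∈ y≢n u∈)
    ...     | yes refl with IsPath-meetsRow path zero
    ...       | (_ , y′) , p′∈ , refl = _ , p′∈ , ℤₚ.+-monoʳ-≤ (r zero) (c-min y′)

    p-ru-covered : maxList (map W p-ru) ≤ maxList (map W p-ur) → ∀ {u} → u ∈ p-ru → Covered q u
    p-ru-covered ru≤ur u∈ with ∈-p-ru⁻ u∈
    ... | inj₁ (y , refl) = firstRow-covered ru≤ur y
    ... | inj₂ (x , refl) = lastCol-covered x

  p-ru-dominates : maxList (map W p-ru) ≤ maxList (map W p-ur) →
                   ∀ q → IsPath q → Dominates (map W p-ru) (map W q)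
  p-ru-dominates ru≤ur q@(p ∷ ps) path = RightUp.p-ru-dominates r c colBound (λ _ _ → c-min _) q path
    (maxList-map-≤ W _ _ p ps (p-ru-covered path ru≤ur))

module MinimaFirst {m n : ℕ} {r : Fin (suc m) → ℤ} {c : Fin (suc n) → ℤ}
  (r-min : ∀ x → r zero ≤ r x) (r-next : ∀ x → x ≢ zero → r (fromℕ m) ≤ r x)
  (c-min : ∀ y → c zero ≤ c y) (c-next : ∀ y → y ≢ zero → c (fromℕ n) ≤ c y) where

  open RightUp r c hiding (p-ru-dominates)

  rowBound : ∀ {x y b} → b ≤ₚ (x , y) → ruMax ≤ W b → c (fromℕ n) ≤ c y
  rowBound {_} {y} {xb , yb} (_ , yb≤y) peak with y ≟ zero
  ... | no y≢0 = c-next y y≢0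
  ... | yes refl = +-cancelˡ-≤ (r xb) (subst (λ y′ → W (xb , fromℕ n) ≤ W (xb , y′))
                     (Finₚ.toℕ-injective (ℕₚ.n≤0⇒n≡0 yb≤y))
                     (ℤₚ.≤-trans (maxList-map-upper W _ _ (lastCol∈p-ru xb)) peak))

  module _ {q : List (Pos {m} {n})} (path : IsPath q) where

    firstRow-covered : ∀ y → Covered q (zero , y)
    firstRow-covered y with IsPath-meetsCol path y
    ... | (x , _) , p∈ , refl = _ , p∈ , ℤₚ.+-monoˡ-≤ (c y) (r-min x)

    p-ur-covered : ∀ {x} → (suc x , zero) ∈ q → ∀ {u} → u ∈ p-ur → Covered q u
    p-ur-covered x0∈ u∈ with ∈-p-ur⁻ u∈
    ... | inj₁ (x , refl) with IsPath-meetsRow path x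
    ...   | (_ , y) , p∈ , refl = _ , p∈ , ℤₚ.+-monoʳ-≤ (r x) (c-min y)
    p-ur-covered x0∈ u∈ | inj₂ (j , refl) with IsPath-meetsCol path (suc j)
    ... | (x , _) , p∈ , refl with x ≟ zero
    ...   | no x≢0 = _ , p∈ , ℤₚ.+-monoˡ-≤ (c (suc j)) (r-next x x≢0)
    ...   | yes refl = ⊥-elim (incomparable (IsPath-comparable path p∈ x0∈))
      where
      incomparable : ∀ {x′ y′} →
                     (zero , suc y′) ≤ₚ (suc x′ , zero) ⊎ (suc x′ , zero) ≤ₚ (zero , suc y′) → ⊥
      incomparable (inj₁ (_ , ()))
      incomparable (inj₂ (() , _))

    lastCol-covered : maxList (map W p-ru) ≤ maxList (map W p-ur) → ∀ x → Covered q (suc x , fromℕ n)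
    lastCol-covered ru≤ur x with IsPath-meetsRow path (suc x)
    ... | (_ , y) , p∈ , refl with y ≟ zero
    ...   | no y≢0 = _ , p∈ , ℤₚ.+-monoʳ-≤ (r (suc x)) (c-next y y≢0)
    ...   | yes refl = let u , u∈ , le = maxList-map-≤⁻ W _ _ _ _ ru≤ur (lastCol∈p-ru (suc x))
                       in covered-≤ le (p-ur-covered p∈ u∈)

    p-ru-covered : maxList (map W p-ru) ≤ maxList (map W p-ur) → ∀ {u} → u ∈ p-ru → Covered q u
    p-ru-covered ru≤ur u∈ with ∈-p-ru⁻ u∈
    ... | inj₁ (y , refl) = firstRow-covered y
    ... | inj₂ (x , refl) = lastCol-covered ru≤ur x

  p-ru-dominates : maxList (map W p-ru) ≤ maxList (map W p-ur) →
                   ∀ q → IsPath q → Dominates (map W p-ru) (map W q)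
  p-ru-dominates ru≤ur q@(p ∷ ps) path = RightUp.p-ru-dominates r c (λ _ _ → r-min _) rowBound q path
    (maxList-map-≤ W _ _ p ps (p-ru-covered path ru≤ur))

p-ur-dominates-by-transpose : ∀ {m n} (r : Fin (suc m) → ℤ) (c : Fin (suc n) → ℤ) →
  (maxList (map (merge c r) p-ru) ≤ maxList (map (merge c r) p-ur) →
   ∀ q → IsPath {n} {m} q → Dominates (map (merge c r) p-ru) (map (merge c r) q)) →
  maxList (map (merge r c) p-ur) ≤ maxList (map (merge r c) p-ru) →
  ∀ q → IsPath {m} {n} q → Dominates (map (merge r c) p-ur) (map (merge r c) q)
p-ur-dominates-by-transpose r c ru-dominates ur≤ru q path =
  subst₂ Dominates ur-entries (merge-transpose r c q)
    (ru-dominates (subst₂ _≤_ (cong maxList (sym ur-entries)) (cong maxList (sym ru-entries)) ur≤ru)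
                  (map swap q) (IsPath-transpose q path))
  where
  ur-entries : map (merge c r) p-ru ≡ map (merge r c) p-ur
  ur-entries = trans (cong (map (merge c r)) (sym p-ur-transpose)) (merge-transpose r c p-ur)
  ru-entries : map (merge c r) p-ur ≡ map (merge r c) p-ru
  ru-entries = trans (cong (map (merge c r)) (sym p-ru-transpose)) (merge-transpose r c p-ru)

lemma3p8 : (m n : ℕ) (r : Fin (suc m) → ℤ) (c : Fin (suc n) → ℤ)
    (i k : Fin (suc m)) (j l : Fin (suc n)) →
    (∀ x → r i ≤ r x) →
    (∀ y → c j ≤ c y) →
    k ≢ i → (∀ x → x ≢ i → r k ≤ r x) →
    l ≢ j → (∀ y → y ≢ j → c l ≤ c y) →
    (pstar qstar : List (Pos {m} {n})) →
    ((pstar ≡ p-ru × qstar ≡ p-ur) ⊎ (pstar ≡ p-ur × qstar ≡ p-ru)) →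
    maxList (entries (merge r c) pstar) ≤ maxList (entries (merge r c) qstar) →
    ((i ≡ fromℕ m × j ≡ fromℕ n × k ≡ zero × l ≡ zero)
      ⊎ (i ≡ zero × j ≡ zero × k ≡ fromℕ m × l ≡ fromℕ n)) →
    (q : List (Pos {m} {n})) → IsPath q →
    Dominates (entries (merge r c) pstar) (entries (merge r c) q)
lemma3p8 m n r c i k j l r-min c-min _ r-next _ c-next pstar qstar choice p≤q minima q path
  with minima | choice
... | inj₁ (refl , refl , refl , refl) | inj₁ (refl , refl) =
  MinimaLast.p-ru-dominates r-min r-next c-min c-next p≤q q path
... | inj₁ (refl , refl , refl , refl) | inj₂ (refl , refl) =
  p-ur-dominates-by-transpose r c (MinimaLast.p-ru-dominates c-min c-next r-min r-next) p≤q q path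
... | inj₂ (refl , refl , refl , refl) | inj₁ (refl , refl) =
  MinimaFirst.p-ru-dominates r-min r-next c-min c-next p≤q q path
... | inj₂ (refl , refl , refl , refl) | inj₂ (refl , refl) =
  p-ur-dominates-by-transpose r c (MinimaFirst.p-ru-dominates c-min c-next r-min r-next) p≤q q path
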